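{- Let $C$, $C'$ be cycles, $S\subseteq V(C)$, $S'\subseteq V(C')$, with $(C,S)$ distance regular, and let $k\ge2$ be such that the subdivided torus $(C,S)\boxplus(C',S')$ allows the $k$-wiggle decomposition (i.e. $k\mid |S|$, $|S'|\ge k$, $|S'|\equiv k\pmod 2$). Let $C_1,\dots,C_k$ be the cycles of the $k$-wiggle decomposition of $(C,S)\boxplus(C',S')$. Then there are sets $S_1,\dots,S_k$, all of the same cardinality, partitioning $V(C)\times S'$, such that $S_\ell\subseteq V(C_\ell)$ for $1\le\ell\le k$.
   Context: Cartesian product $G\,\square\,H$: vertex set $V(G)\times V(H)$, $(u,v)(u',v')$ an edge iff ($u=u'$, $vv'\in E(H)$) or ($v=v'$, $uu'\in E(G)$). Anchored product: for $S\subseteq V(G)$, $S'\subseteq V(G')$, $(G,S)\boxplus(G',S')$ has vertex set $\{(u,v): u\in S\text{ or }v\in S'\}$ and edge set $\{(u,v)(u',v): uu'\in E(G), v\in S'\}\cup\{(u,v)(u,v'): u\in S, vv'\in E(G')\}$. For cycles $C,C'$ this is a subdivided torus; its underlying torus is $D\,\square\,D'$ where $D$ is the cycle on $S$ with consecutive vertices the consecutive elements of $S$ along $C$ (each edge representing the path of $C$ between them), similarly $D'$ on $S'$ (a cycle of length 2 means two vertices joined by two parallel edges); the subdivided torus is obtained from the underlying torus by subdividing its edges accordingly. A pair $(C,S)$ is distance regular if, traversing $C$ in a fixed direction, all paths between consecutive elements of $S$ have the same length. $k$-wiggle decomposition of a torus $C\,\square\,C'$ with $C=(0,\dots,N-1,0)$,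 $C'=(0,\dots,M-1,0)$, $k\mid N$, $M=2s+k$, $s\ge0$: cycles $C_1,\dots,C_k$ with $E(C_\ell)$ the union of $\{(i,j)(i+1,j): 0\le j\le M-k-1,\ i\equiv \ell \pmod k\}$; $\{(i,j)(i+1,j): 0\le p\le k-1,\ i\equiv \ell+p\pmod k,\ j=M-k+p\}$; $\{(i,j)(i,j+1): i\equiv\ell\pmod k,\ 0\le j\le M-k-1,\ j\text{ odd}\}$; $\{(i,j)(i,j+1): i\equiv \ell+1\pmod k,\ 0\le j\le M-k-1,\ j\text{ even}\}$; $\{(i,j)(i,j+1): 0\le p\le k-1,\ j=M-k+p,\ i\equiv \ell+p+1\pmod k\}$ (first coordinates mod $N$, second mod $M$). The $k$-wiggle decomposition of a subdivided torus is obtained from that of its underlying torus (vertices of $S$, $S'$ labelled consecutively along $C$, $C'$) by putting every edge obtained by subdividing an edge of the underlying torus into the same cycle as that edge. -}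

module Defs where

open import Data.Nat using (ℕ; zero; suc; _+_; _∸_; _≤_; _<_)
open import Data.Nat.Divisibility using (_∣_)
open import Data.Fin using (Fin; toℕ; _≟_)
import Data.Fin as F
open import Data.Product using (_×_; ∃; ∃₂)
open import Data.Sum using (_⊎_)
open import Relation.Nullary using (¬_; does)
open import Relation.Binary.PropositionalEquality using (_≡_)
open import Data.Bool using (if_then_else_)

-- a ≡ b (mod k), i.e. k divides |a - b|
ModEq : ℕ → ℕ → ℕ → Set
ModEq k a b = (k ∣ (a ∸ b)) × (k ∣ (b ∸ a))

-- b is the successor of a on the cycle Z_n = (0,1,...,n-1,0)
Next : ℕ → ℕ → ℕ → Set
Next n a b = ModEq n b (suc a)

-- σ strictly increasing: S = image σ, labelled consecutively along C
StrictInc : ∀ {N n} → (Fin N → Fin n) → Set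
StrictInc σ = ∀ i j → i F.< j → σ i F.< σ j

InImg : ∀ {N} (n : ℕ) → (Fin N → Fin n) → ℕ → Set
InImg n σ x = ∃ λ i → ModEq n (toℕ (σ i)) x

DistanceRegular : ∀ {N} (n : ℕ) → (Fin N → Fin n) → Set
DistanceRegular n σ = ∃ λ d → (0 < d) × (∀ i →
  InImg n σ (toℕ (σ i) + d) ×
  (∀ t → 0 < t → t < d → ¬ InImg n σ (toℕ (σ i) + t)))

-- u lies on the path of C from σ i forward to the next element of S
-- (excluding that next element); i.e. the edge u(u+1) of C lies on the
-- path subdividing the edge (i,i+1) of the cycle D on S
InArc : ∀ {N} (n : ℕ) → (Fin N → Fin n) → Fin N → Fin n → Set
InArc n σ i u = ∃ λ t → ModEq n (toℕ u) (toℕ (σ i) + t) ×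
  (∀ t' → 0 < t' → t' ≤ t → ¬ InImg n σ (toℕ (σ i) + t'))

-- k-wiggle decomposition of the underlying torus D □ D' (|D| = N, |D'| = M),
-- cycles indexed by ℓ : Fin k (ℓ = 0 playing the role of ℓ = k).
-- Horizontal edge (i,j)(i+1,j) belongs to C_ℓ:
HorW : (k M : ℕ) → ℕ → ℕ → ℕ → Set
HorW k M ℓ i j =
  (j + k < M × ModEq k i ℓ) ⊎
  (M ≤ j + k × ModEq k i (ℓ + (j + k ∸ M)))

-- Vertical edge (i,j)(i,j+1) belongs to C_ℓ:
VerW : (k M : ℕ) → ℕ → ℕ → ℕ → Set
VerW k M ℓ i j =
  (j + k < M × ModEq 2 j 1 × ModEq k i ℓ) ⊎
  (j + k < M × ModEq 2 j 0 × ModEq k i (ℓ + 1)) ⊎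
  (M ≤ j + k × ModEq k i (ℓ + (j + k ∸ M) + 1))

module Wiggle {n m N M : ℕ} (k : ℕ) (σ : Fin N → Fin n) (τ : Fin M → Fin m) where

  -- edge (u, τ j)(u+1, τ j) of the subdivided torus (C,S) ⊞ (C',S') lies in C_ℓ
  HorSub : Fin k → Fin n → Fin M → Set
  HorSub ℓ u j = ∃ λ i → InArc n σ i u × HorW k M (toℕ ℓ) (toℕ i) (toℕ j)

  -- edge (σ i, w)(σ i, w+1) of the subdivided torus lies in C_ℓ
  VerSub : Fin k → Fin N → Fin m → Set
  VerSub ℓ i w = ∃ λ j → InArc m τ j w × VerW k M (toℕ ℓ) (toℕ i) (toℕ j)

  -- (x,y) ∈ V(C_ℓ): it is an endpoint of some edge of C_ℓ
  InV : Fin k → Fin n → Fin m → Set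
  InV ℓ x y =
    (∃₂ λ u j → HorSub ℓ u j × y ≡ τ j × (x ≡ u ⊎ Next n (toℕ u) (toℕ x))) ⊎
    (∃₂ λ i w → VerSub ℓ i w × x ≡ σ i × (y ≡ w ⊎ Next m (toℕ w) (toℕ y)))

sumFin : (n : ℕ) → (Fin n → ℕ) → ℕ
sumFin zero f = 0
sumFin (suc n) f = f F.zero + sumFin n (λ i → f (F.suc i))

-- cardinality of the part S_ℓ = { (u, τ j) : f u j = ℓ } of the partition
-- of V(C) × S' described by the labelling f
partSize : ∀ {n M k} → (Fin n → Fin M → Fin k) → Fin k → ℕ
partSize {n} {M} f ℓ =
  sumFin n (λ u → sumFin M (λ j → if does (f u j ≟ ℓ) then 1 else 0))

module Submission where

-- Write a = σ 0, and let d be the common distance of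
-- consecutive elements of S along C.  Distance regularity forces
-- S = {a, a + d, …, a + (N-1)d} and n = N·d (module `RegularPlacement`), so
-- every vertex u of C lies on the arc of C that starts at the element σ i,
-- i = ((u - a) mod n) div d.  That arc subdivides the edge (i,i+1) of the
-- underlying torus in every row j, and the horizontal edge ((i,j),(i+1,j))
-- belongs to the wiggle cycle C_ℓ with ℓ ≡ i + shift j (mod k)
-- (`horizontal-wiggle`).  We put (u, τ j) into S_ℓ for exactly this ℓ; it is
-- then an endpoint of an edge of C_ℓ.  For the cardinalities, in every row
-- the map u ↦ i takes each value i < N exactly d times (a rotation of Z_n
-- followed by blocks of length d), and as k ∣ N the residues (i + shift j) mod
-- k take every value N/k times; hence |S_ℓ| = M · (N/k) · d for every ℓ.

open import Defs
open import Data.Nat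
open import Data.Nat.Properties
open import Data.Nat.DivMod
open import Data.Nat.Divisibility using (_∣_; divides)
open import Data.Fin using (Fin; toℕ; fromℕ<)
import Data.Fin as F
open import Data.Fin.Properties using (toℕ<n; toℕ-injective; toℕ-fromℕ<; toℕ-fromℕ)
open import Data.Product using (_×_; _,_; proj₁; proj₂; ∃)
open import Data.Sum using (inj₁; inj₂)
open import Data.Bool using (if_then_else_)
open import Relation.Nullary using (¬_; Dec; does; yes; no)
open import Data.Empty using (⊥)
open import Relation.Nullary.Decidable using (does-⇔)
open import Relation.Binary.PropositionalEquality
open import Function using (_∘_; mk⇔)
open import Algebra.Properties.CommutativeMonoid.Sum +-0-commutativeMonoid
  using (sum; sum-cong-≗; ∑-comm)

%⇒∣∸ : ∀ k .{{_ : NonZero k}} a b → a % k ≡ b % k → k ∣ (a ∸ b)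
%⇒∣∸ k a b e = divides (a / k ∸ b / k) (begin
  a ∸ b                                      ≡⟨ cong₂ _∸_ (m≡m%n+[m/n]*n a k) (m≡m%n+[m/n]*n b k) ⟩
  (a % k + a / k * k) ∸ (b % k + b / k * k)  ≡⟨ cong (λ z → (a % k + a / k * k) ∸ (z + b / k * k)) (sym e) ⟩
  (a % k + a / k * k) ∸ (a % k + b / k * k)  ≡⟨ [m+n]∸[m+o]≡n∸o (a % k) _ _ ⟩
  a / k * k ∸ b / k * k                      ≡⟨ sym (*-distribʳ-∸ k (a / k) (b / k)) ⟩
  (a / k ∸ b / k) * k                        ∎)
  where open ≡-Reasoning

%⇒ModEq : ∀ k .{{_ : NonZero k}} a b → a % k ≡ b % k → ModEq k a b
%⇒ModEq k a b e = %⇒∣∸ k a b e , %⇒∣∸ k b a (sym e)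

ModEq⇒% : ∀ k .{{_ : NonZero k}} a b → ModEq k a b → a % k ≡ b % k
ModEq⇒% k a b (k∣a∸b , k∣b∸a) with ≤-total a b
... | inj₁ a≤b = sym (trans (%-congˡ (sym (m+[n∸m]≡n a≤b))) (%-remove-+ʳ a k∣b∸a))
... | inj₂ b≤a = trans (%-congˡ (sym (m+[n∸m]≡n b≤a))) (%-remove-+ʳ b k∣a∸b)

ModEq-residue : ∀ n .{{_ : NonZero n}} x y → x < n → ModEq n x y → x ≡ y % n
ModEq-residue n x y x<n x≡y = trans (sym (m<n⇒m%n≡m x<n)) (ModEq⇒% n x y x≡y)

[m+n%o]%o≡[m+n]%o : ∀ m n o .{{_ : NonZero o}} → (m + n % o) % o ≡ (m + n) % o
[m+n%o]%o≡[m+n]%o m n o = begin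
  (m + n % o) % o            ≡⟨ %-distribˡ-+ m (n % o) o ⟩
  (m % o + n % o % o) % o    ≡⟨ cong (λ z → (m % o + z) % o) (m%n%n≡m%n n o) ⟩
  (m % o + n % o) % o        ≡⟨ sym (%-distribˡ-+ m n o) ⟩
  (m + n) % o                ∎
  where open ≡-Reasoning

Sum : ℕ → (ℕ → ℕ) → ℕ
Sum zero    h = 0
Sum (suc n) h = h 0 + Sum n (h ∘ suc)

sumFin≡Sum : ∀ n (h : ℕ → ℕ) → sumFin n (h ∘ toℕ) ≡ Sum n h
sumFin≡Sum zero    h = refl
sumFin≡Sum (suc n) h = cong (h 0 +_) (sumFin≡Sum n (h ∘ suc))

sumFin≡sum : ∀ n (f : Fin n → ℕ) → sumFin n f ≡ sum f
sumFin≡sum zero    f = refl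
sumFin≡sum (suc n) f = cong (f F.zero +_) (sumFin≡sum n (f ∘ F.suc))

sumFin-cong : ∀ n {f g : Fin n → ℕ} → (∀ i → f i ≡ g i) → sumFin n f ≡ sumFin n g
sumFin-cong n f≗g = trans (sumFin≡sum n _) (trans (sum-cong-≗ f≗g) (sym (sumFin≡sum n _)))

sumFin-swap : ∀ n M (g : Fin n → Fin M → ℕ) →
  sumFin n (λ u → sumFin M (g u)) ≡ sumFin M (λ j → sumFin n (λ u → g u j))
sumFin-swap n M g = begin
  sumFin n (λ u → sumFin M (g u))          ≡⟨ sumFin≡sum n _ ⟩
  sum (λ u → sumFin M (g u))               ≡⟨ sum-cong-≗ (λ u → sumFin≡sum M (g u)) ⟩
  sum (λ u → sum (g u))                    ≡⟨ ∑-comm g ⟩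
  sum (λ j → sum (λ u → g u j))            ≡⟨ sum-cong-≗ (λ j → sym (sumFin≡sum n (λ u → g u j))) ⟩
  sum (λ j → sumFin n (λ u → g u j))       ≡⟨ sym (sumFin≡sum M _) ⟩
  sumFin M (λ j → sumFin n (λ u → g u j))  ∎
  where open ≡-Reasoning

Sum-cong : ∀ n {h g : ℕ → ℕ} → (∀ i → i < n → h i ≡ g i) → Sum n h ≡ Sum n g
Sum-cong zero    h≡g = refl
Sum-cong (suc n) h≡g = cong₂ _+_ (h≡g 0 z<s) (Sum-cong n (λ i i<n → h≡g (suc i) (s<s i<n)))

Sum-const : ∀ n c → Sum n (λ _ → c) ≡ n * c
Sum-const zero    c = refl
Sum-const (suc n) c = cong (c +_) (Sum-const n c)

Sum-+ : ∀ p q h → Sum (p + q) h ≡ Sum p h + Sum q (λ i → h (p + i))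
Sum-+ zero    q h = refl
Sum-+ (suc p) q h = trans (cong (h 0 +_) (Sum-+ p q (h ∘ suc))) (sym (+-assoc (h 0) _ _))

Sum-blocks : ∀ p q h → Sum (p * q) h ≡ Sum p (λ i → Sum q (λ t → h (i * q + t)))
Sum-blocks zero    q h = refl
Sum-blocks (suc p) q h = trans (Sum-+ q (p * q) h) (cong (Sum q h +_) (begin
  Sum (p * q) (λ i → h (q + i))                        ≡⟨ Sum-blocks p q (λ i → h (q + i)) ⟩
  Sum p (λ i → Sum q (λ t → h (q + (i * q + t))))      ≡⟨ Sum-cong p (λ i _ → Sum-cong q (λ t _ →
                                                            cong h (sym (+-assoc q (i * q) t)))) ⟩
  Sum p (λ i → Sum q (λ t → h (q + i * q + t)))        ∎))
  where open ≡-Reasoning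

Sum-quotient : ∀ p d .{{_ : NonZero d}} h → Sum (p * d) (λ v → h (v / d)) ≡ Sum p (λ i → d * h i)
Sum-quotient p d h = begin
  Sum (p * d) (λ v → h (v / d))                 ≡⟨ Sum-blocks p d _ ⟩
  Sum p (λ i → Sum d (λ t → h ((i * d + t) / d))) ≡⟨ Sum-cong p (λ i _ → Sum-cong d (λ t t<d → cong h (block-quotient i t t<d))) ⟩
  Sum p (λ i → Sum d (λ _ → h i))               ≡⟨ Sum-cong p (λ i _ → Sum-const d (h i)) ⟩
  Sum p (λ i → d * h i)                         ∎
  where
  open ≡-Reasoning
  block-quotient : ∀ i t → t < d → (i * d + t) / d ≡ i
  block-quotient i t t<d = begin
    (i * d + t) / d    ≡⟨ +-distrib-/-∣ˡ t (divides i refl) ⟩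
    i * d / d + t / d  ≡⟨ cong₂ _+_ (m*n/n≡m i d) (m<n⇒m/n≡0 t<d) ⟩
    i + 0              ≡⟨ +-identityʳ i ⟩
    i                  ∎

Sum-rotate : ∀ n .{{_ : NonZero n}} c h → Sum n (λ u → h ((u + c) % n)) ≡ Sum n h
Sum-rotate n c h = begin
  Sum n (λ u → h ((u + c) % n))                ≡⟨ Sum-cong n (λ u _ → cong h (sym ([m+n%o]%o≡[m+n]%o u c n))) ⟩
  Sum n (λ u → h ((u + c′) % n))               ≡⟨ cong (λ z → Sum z (λ u → h ((u + c′) % n))) (sym b+c′) ⟩
  Sum (b + c′) (λ u → h ((u + c′) % n))        ≡⟨ Sum-+ b c′ _ ⟩
  Sum b (λ u → h ((u + c′) % n)) + Sum c′ (λ w → h ((b + w + c′) % n))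
    ≡⟨ cong₂ _+_ (Sum-cong b (λ u u<b → cong h (no-wrap u u<b))) (Sum-cong c′ (λ w w<c′ → cong h (wrap w w<c′))) ⟩
  Sum b (λ u → h (u + c′)) + Sum c′ h          ≡⟨ +-comm _ (Sum c′ h) ⟩
  Sum c′ h + Sum b (λ u → h (u + c′))          ≡⟨ cong (Sum c′ h +_) (Sum-cong b (λ u _ → cong h (+-comm u c′))) ⟩
  Sum c′ h + Sum b (λ u → h (c′ + u))          ≡⟨ sym (Sum-+ c′ b h) ⟩
  Sum (c′ + b) h                               ≡⟨ cong (λ z → Sum z h) (trans (+-comm c′ b) b+c′) ⟩
  Sum n h                                      ∎
  where
  open ≡-Reasoning
  c′ b : ℕ
  c′ = c % n
  b = n ∸ c′
  b+c′ : b + c′ ≡ n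
  b+c′ = m∸n+n≡m (m%n≤n c n)
  no-wrap : ∀ u → u < b → (u + c′) % n ≡ u + c′
  no-wrap u u<b = m<n⇒m%n≡m (subst (u + c′ <_) b+c′ (+-monoˡ-< c′ u<b))
  wrap : ∀ w → w < c′ → (b + w + c′) % n ≡ w
  wrap w w<c′ = begin
    (b + w + c′) % n  ≡⟨ %-congˡ (trans (cong (_+ c′) (+-comm b w)) (trans (+-assoc w b c′) (cong (w +_) b+c′))) ⟩
    (w + n) % n       ≡⟨ [m+n]%n≡m%n w n ⟩
    w % n             ≡⟨ m<n⇒m%n≡m (<-≤-trans w<c′ (m%n≤n c n)) ⟩
    w                 ∎

ind : ℕ → ℕ → ℕ
ind x y = if does (x ≟ y) then 1 else 0

ind-toℕ : ∀ {k} (x y : Fin k) → (if does (x F.≟ y) then 1 else 0) ≡ ind (toℕ x) (toℕ y)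
ind-toℕ x y = cong (λ b → if b then 1 else 0)
  (does-⇔ (mk⇔ (cong toℕ) toℕ-injective) (x F.≟ y) (toℕ x ≟ toℕ y))

Sum-point : ∀ k ℓ c → ℓ < k → Sum k (λ i → c * ind i ℓ) ≡ c
Sum-point (suc k) zero    c _ = begin
  c * 1 + Sum k (λ i → c * 0)  ≡⟨ cong₂ _+_ (*-identityʳ c) (Sum-cong k (λ i _ → *-zeroʳ c)) ⟩
  c + Sum k (λ _ → 0)          ≡⟨ cong (c +_) (trans (Sum-const k 0) (*-zeroʳ k)) ⟩
  c + 0                        ≡⟨ +-identityʳ c ⟩
  c                            ∎
  where open ≡-Reasoning
Sum-point (suc k) (suc ℓ) c (s<s ℓ<k) =
  trans (cong (_+ Sum k (λ i → c * ind i ℓ)) (*-zeroʳ c)) (Sum-point k ℓ c ℓ<k)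

Sum-residue : ∀ q k .{{_ : NonZero k}} s c ℓ → ℓ < k →
  Sum (q * k) (λ i → c * ind ((i + s) % k) ℓ) ≡ q * c
Sum-residue q k s c ℓ ℓ<k = begin
  Sum (q * k) (λ i → c * ind ((i + s) % k) ℓ)                   ≡⟨ Sum-blocks q k _ ⟩
  Sum q (λ p → Sum k (λ i → c * ind ((p * k + i + s) % k) ℓ))   ≡⟨ Sum-cong q (λ p _ → Sum-cong k (λ i _ →
                                                                     cong (λ z → c * ind z ℓ) (periodic p i))) ⟩
  Sum q (λ p → Sum k (λ i → c * ind ((i + s) % k) ℓ))           ≡⟨ Sum-cong q (λ _ _ → Sum-rotate k s (λ x → c * ind x ℓ)) ⟩
  Sum q (λ p → Sum k (λ i → c * ind i ℓ))                       ≡⟨ Sum-cong q (λ _ _ → Sum-point k ℓ c ℓ<k) ⟩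
  Sum q (λ _ → c)                                               ≡⟨ Sum-const q c ⟩
  q * c                                                         ∎
  where
  open ≡-Reasoning
  periodic : ∀ p i → (p * k + i + s) % k ≡ (i + s) % k
  periodic p i = trans (%-congˡ (trans (+-assoc (p * k) i s) (+-comm (p * k) (i + s))))
    ([m+kn]%n≡m%n (i + s) p k)

-- The hypothesis `gaps` is the content of `DistanceRegular`.
module RegularPlacement {N′ n′ : ℕ} (σ : Fin (suc N′) → Fin (suc n′)) (σ-inc : StrictInc σ)
  (d : ℕ) (0<d : 0 < d)
  (gaps : ∀ i → InImg (suc n′) σ (toℕ (σ i) + d) ×
                (∀ t → 0 < t → t < d → ¬ InImg (suc n′) σ (toℕ (σ i) + t))) where

  private
    n N : ℕ
    n = suc n′
    N = suc N′

  s : Fin N → ℕ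
  s i = toℕ (σ i)

  a : ℕ
  a = s F.zero

  σ-mono : ∀ i j → toℕ i ≤ toℕ j → s i ≤ s j
  σ-mono i j i≤j with m≤n⇒m<n∨m≡n i≤j
  ... | inj₁ i<j = <⇒≤ (σ-inc i j i<j)
  ... | inj₂ i≡j = ≤-reflexive (cong s (toℕ-injective i≡j))

  σ-reflect : ∀ i j → s i < s j → toℕ i < toℕ j
  σ-reflect i j si<sj = ≰⇒> (λ j≤i → <⇒≱ si<sj (σ-mono j i j≤i))

  gap : ∀ i p t → 0 < t → ModEq n (s p) (s i + t) → d ≤ t
  gap i p t 0<t hit = ≮⇒≥ (λ t<d → proj₂ (gaps i) t 0<t t<d (p , hit))

  landing : ∀ i → s i + d < n → ∃ λ p → s p ≡ s i + d
  landing i below with proj₁ (gaps i)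
  ... | p , hit = p , trans (ModEq-residue n (s p) (s i + d) (toℕ<n (σ p)) hit) (m<n⇒m%n≡m below)

  step : ∀ i i′ → toℕ i′ ≡ suc (toℕ i) → s i′ ≡ s i + d
  step i i′ i′≡1+i = ≤-antisym upper lower
    where
    si<si′ : s i < s i′
    si<si′ = σ-inc i i′ (≤-reflexive (sym i′≡1+i))
    si+t : s i + (s i′ ∸ s i) ≡ s i′
    si+t = m+[n∸m]≡n (<⇒≤ si<si′)
    lower : s i + d ≤ s i′
    lower = subst (s i + d ≤_) si+t (+-monoʳ-≤ (s i)
      (gap i i′ (s i′ ∸ s i) (m<n⇒0<n∸m si<si′) (%⇒ModEq n (s i′) (s i + (s i′ ∸ s i)) (%-congˡ (sym si+t)))))
    -- an element strictly between σ i and σ i′ would sit between i and i + 1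
    upper : s i′ ≤ s i + d
    upper = ≮⇒≥ λ si+d<si′ → let (p , sp) = landing i (<-trans si+d<si′ (toℕ<n (σ i′))) in
      <⇒≱ (subst (s i <_) (sym sp) (m<m+n (s i) 0<d))
        (σ-mono p i (s≤s⁻¹ (subst (toℕ p <_) i′≡1+i (σ-reflect p i′ (subst (_< s i′) (sym sp) si+d<si′)))))

  σ-arith : ∀ m i → toℕ i ≡ m → s i ≡ a + m * d
  σ-arith zero    i i≡0 = trans (cong s (toℕ-injective i≡0)) (sym (+-identityʳ a))
  σ-arith (suc m) i′ i′≡1+m = begin
    s i′               ≡⟨ step i i′ (trans i′≡1+m (cong suc (sym (toℕ-fromℕ< m<N)))) ⟩
    s i + d            ≡⟨ cong (_+ d) (σ-arith m i (toℕ-fromℕ< m<N)) ⟩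
    a + m * d + d      ≡⟨ +-assoc a (m * d) d ⟩
    a + (m * d + d)    ≡⟨ cong (a +_) (+-comm (m * d) d) ⟩
    a + suc m * d      ∎
    where
    open ≡-Reasoning
    m<N : m < N
    m<N = <-trans (n<1+n m) (subst (_< N) i′≡1+m (toℕ<n i′))
    i : Fin N
    i = fromℕ< m<N

  σ-form : ∀ i → s i ≡ a + toℕ i * d
  σ-form i = σ-arith (toℕ i) i refl

  last : Fin N
  last = F.fromℕ N′

  last-gap : s last + d ≤ a + n
  last-gap = subst (s last + d ≤_) L+t (+-monoʳ-≤ (s last)
      (gap last F.zero (a + n ∸ s last) (m<n⇒0<n∸m L<a+n)
        (%⇒ModEq n a (s last + (a + n ∸ s last)) (trans (sym ([m+n]%n≡m%n a n)) (%-congˡ (sym L+t))))))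
    where
    L<a+n : s last < a + n
    L<a+n = ≤-trans (toℕ<n (σ last)) (m≤n+m n a)
    L+t : s last + (a + n ∸ s last) ≡ a + n
    L+t = m+[n∸m]≡n (<⇒≤ L<a+n)

  -- It is also at most d away: otherwise the element of S lying d steps after
  -- the last one would come either after the last element or before the first.
  last-step : a + n ≤ s last + d
  last-step = ≮⇒≥ λ short → misplaced short (s last + d <? n)
    where
    misplaced : s last + d < a + n → Dec (s last + d < n) → ⊥
    misplaced _ (yes L+d<n) = let (p , sp) = landing last L+d<n in
      <⇒≱ (subst (s last <_) (sym sp) (m<m+n (s last) 0<d))
        (σ-mono p last (subst (toℕ p ≤_) (sym (toℕ-fromℕ N′)) (s≤s⁻¹ (toℕ<n p))))
    misplaced short (no L+d≮n) with proj₁ (gaps last)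
    ... | p , hit = <⇒≱ (subst (_< a) (sym sp≡w) w<a) (σ-mono F.zero p z≤n)
      where
      open ≡-Reasoning
      w : ℕ
      w = s last + d ∸ n
      w+n : w + n ≡ s last + d
      w+n = m∸n+n≡m (≮⇒≥ L+d≮n)
      w<a : w < a
      w<a = +-cancelʳ-< n w a (subst (_< a + n) (sym w+n) short)
      sp≡w : s p ≡ w
      sp≡w = begin
        s p               ≡⟨ ModEq-residue n (s p) (s last + d) (toℕ<n (σ p)) hit ⟩
        (s last + d) % n  ≡⟨ %-congˡ (sym w+n) ⟩
        (w + n) % n       ≡⟨ [m+n]%n≡m%n w n ⟩
        w % n             ≡⟨ m<n⇒m%n≡m (<-trans w<a (toℕ<n (σ F.zero))) ⟩
        w                 ∎

  length : n ≡ N * d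
  length = +-cancelˡ-≡ a n (N * d) (begin
    a + n              ≡⟨ ≤-antisym last-step last-gap ⟩
    s last + d         ≡⟨ cong (_+ d) (trans (σ-form last) (cong (λ z → a + z * d) (toℕ-fromℕ N′))) ⟩
    a + N′ * d + d     ≡⟨ +-assoc a (N′ * d) d ⟩
    a + (N′ * d + d)   ≡⟨ cong (a +_) (+-comm (N′ * d) d) ⟩
    a + N * d          ∎)
    where open ≡-Reasoning

-- In a row j < M - k the
-- horizontal edge leaving column i lies in C_ℓ for ℓ ≡ i; in one of the last k
-- rows, j = M - k + e, it lies in C_ℓ for ℓ ≡ i - e.  Both cases say
-- ℓ ≡ i + wiggleShift k M j (mod k).
wiggleShift : ℕ → ℕ → ℕ → ℕ
wiggleShift k M j = k ∸ (j + k ∸ M)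

horizontal-wiggle : ∀ k .{{_ : NonZero k}} M i j → j < M →
  HorW k M ((i + wiggleShift k M j) % k) i j
horizontal-wiggle k M i j j<M with j + k <? M
... | yes j+k<M = inj₁ (j+k<M , %⇒ModEq k i ((i + wiggleShift k M j) % k) (sym (begin
  (i + wiggleShift k M j) % k % k  ≡⟨ m%n%n≡m%n _ k ⟩
  (i + (k ∸ (j + k ∸ M))) % k      ≡⟨ cong (λ z → (i + (k ∸ z)) % k) (m≤n⇒m∸n≡0 (<⇒≤ j+k<M)) ⟩
  (i + k) % k                      ≡⟨ [m+n]%n≡m%n i k ⟩
  i % k                            ∎)))
  where open ≡-Reasoning
... | no j+k≮M = inj₂ (M≤j+k , %⇒ModEq k i ((i + (k ∸ e)) % k + e) (sym (begin
  ((i + (k ∸ e)) % k + e) % k      ≡⟨ %-congˡ (+-comm _ e) ⟩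
  (e + (i + (k ∸ e)) % k) % k      ≡⟨ [m+n%o]%o≡[m+n]%o e (i + (k ∸ e)) k ⟩
  (e + (i + (k ∸ e))) % k          ≡⟨ %-congˡ (trans (+-comm e _) (trans (+-assoc i (k ∸ e) e) (cong (i +_) (m∸n+n≡m e≤k)))) ⟩
  (i + k) % k                      ≡⟨ [m+n]%n≡m%n i k ⟩
  i % k                            ∎)))
  where
  open ≡-Reasoning
  M≤j+k : M ≤ j + k
  M≤j+k = ≮⇒≥ j+k≮M
  e : ℕ
  e = j + k ∸ M
  e≤k : e ≤ k
  e≤k = subst (e ≤_) (m+n∸m≡n M k) (∸-monoˡ-≤ M (+-monoˡ-≤ k (<⇒≤ j<M)))

-- The partition: (u, τ j) goes to the wiggle cycle containing the horizontal
-- edge leaving (u, τ j), which lies on the arc of C through u.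
module Labelling {N′ n′ m M : ℕ} (k : ℕ) .{{_ : NonZero k}}
  (σ : Fin (suc N′) → Fin (suc n′)) (τ : Fin M → Fin m) (σ-inc : StrictInc σ)
  (d : ℕ) .{{_ : NonZero d}}
  (gaps : ∀ i → InImg (suc n′) σ (toℕ (σ i) + d) ×
                (∀ t → 0 < t → t < d → ¬ InImg (suc n′) σ (toℕ (σ i) + t)))
  (q : ℕ) (N≡qk : suc N′ ≡ q * k) where

  private
    n N : ℕ
    n = suc n′
    N = suc N′

  open RegularPlacement σ σ-inc d (>-nonZero⁻¹ d) gaps using (s; a; σ-form; length)

  -- position of the vertex u of C counted forward from a
  offset : ℕ → ℕ
  offset u = (u + (n ∸ a)) % n

  -- index of the element of S at which the arc containing u starts
  arcIndex : ℕ → ℕ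
  arcIndex u = offset u / d

  arcIndex<N : ∀ u → arcIndex u < N
  arcIndex<N u = m<n*o⇒m/o<n (subst (offset u <_) length (m%n<n (u + (n ∸ a)) n))

  arcOf : Fin n → Fin N
  arcOf u = fromℕ< (arcIndex<N (toℕ u))

  label : Fin n → Fin M → Fin k
  label u j = fromℕ< (m%n<n (arcIndex (toℕ u) + wiggleShift k M (toℕ j)) k)

  -- u lies offset u mod d steps after σ (arcOf u), before the next element of S.
  on-arc : ∀ u → InArc n σ (arcOf u) u
  on-arc u = r % d , %⇒ModEq n U (s i + r % d) (sym (begin
      (s i + r % d) % n            ≡⟨ %-congˡ start+rest ⟩
      (a + r) % n                  ≡⟨ [m+n%o]%o≡[m+n]%o a (U + (n ∸ a)) n ⟩
      (a + (U + (n ∸ a))) % n      ≡⟨ %-congˡ around ⟩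
      (U + n) % n                  ≡⟨ [m+n]%n≡m%n U n ⟩
      U % n                        ∎))
    , λ t 0<t t≤ → proj₂ (gaps i) t 0<t (≤-<-trans t≤ (m%n<n r d))
    where
    open ≡-Reasoning
    U r : ℕ
    U = toℕ u
    r = offset U
    i : Fin N
    i = arcOf u
    start+rest : s i + r % d ≡ a + r
    start+rest = begin
      s i + r % d                  ≡⟨ cong (_+ r % d) (σ-form i) ⟩
      a + toℕ i * d + r % d        ≡⟨ cong (λ z → a + z * d + r % d) (toℕ-fromℕ< (arcIndex<N U)) ⟩
      a + r / d * d + r % d        ≡⟨ +-assoc a _ _ ⟩
      a + (r / d * d + r % d)      ≡⟨ cong (a +_) (trans (+-comm _ (r % d)) (sym (m≡m%n+[m/n]*n r d))) ⟩
      a + r                        ∎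
    around : a + (U + (n ∸ a)) ≡ U + n
    around = trans (sym (+-assoc a U _)) (trans (cong (_+ (n ∸ a)) (+-comm a U))
      (trans (+-assoc U a _) (cong (U +_) (m+[n∸m]≡n (<⇒≤ (toℕ<n (σ F.zero)))))))

  -- (u, τ j) is the left endpoint of a horizontal edge of C_(label u j).
  label-in-cycle : ∀ u j → Wiggle.InV k σ τ (label u j) u (τ j)
  label-in-cycle u j = inj₁ (u , j , (arcOf u , on-arc u , edge) , refl , inj₁ refl)
    where
    x : ℕ
    x = arcIndex (toℕ u) + wiggleShift k M (toℕ j)
    edge : HorW k M (toℕ (label u j)) (toℕ (arcOf u)) (toℕ j)
    edge = subst₂ (λ x y → HorW k M x y (toℕ j))
      (sym (toℕ-fromℕ< (m%n<n x k))) (sym (toℕ-fromℕ< (arcIndex<N (toℕ u))))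
      (horizontal-wiggle k M (arcIndex (toℕ u)) (toℕ j) (toℕ<n j))

  row-size : ∀ j ℓ → sumFin n (λ u → if does (label u j F.≟ ℓ) then 1 else 0) ≡ q * d
  row-size j ℓ = begin
    sumFin n (λ u → if does (label u j F.≟ ℓ) then 1 else 0)
      ≡⟨ sumFin-cong n (λ u → trans (ind-toℕ (label u j) ℓ)
           (cong (λ z → ind z (toℕ ℓ)) (toℕ-fromℕ< (m%n<n (arcIndex (toℕ u) + sh) k)))) ⟩
    sumFin n (λ u → h (offset (toℕ u)))          ≡⟨ sumFin≡Sum n (h ∘ offset) ⟩
    Sum n (λ u → h ((u + (n ∸ a)) % n))          ≡⟨ Sum-rotate n (n ∸ a) h ⟩
    Sum n h                                      ≡⟨ cong (λ z → Sum z h) length ⟩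
    Sum (N * d) h                                ≡⟨ Sum-quotient N d (λ i → ind ((i + sh) % k) (toℕ ℓ)) ⟩
    Sum N (λ i → d * ind ((i + sh) % k) (toℕ ℓ)) ≡⟨ cong (λ z → Sum z (λ i → d * ind ((i + sh) % k) (toℕ ℓ))) N≡qk ⟩
    Sum (q * k) (λ i → d * ind ((i + sh) % k) (toℕ ℓ)) ≡⟨ Sum-residue q k sh d (toℕ ℓ) (toℕ<n ℓ) ⟩
    q * d                                        ∎
    where
    open ≡-Reasoning
    sh : ℕ
    sh = wiggleShift k M (toℕ j)
    h : ℕ → ℕ
    h v = ind ((v / d + sh) % k) (toℕ ℓ)

  part-size : ∀ ℓ → partSize label ℓ ≡ M * (q * d)
  part-size ℓ = begin
    partSize label ℓ                  ≡⟨ sumFin-swap n M (λ u j → if does (label u j F.≟ ℓ) then 1 else 0) ⟩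
    sumFin M (λ j → sumFin n (λ u → if does (label u j F.≟ ℓ) then 1 else 0))
                                      ≡⟨ sumFin-cong M (λ j → row-size j ℓ) ⟩
    sumFin M (λ _ → q * d)            ≡⟨ sumFin≡Sum M (λ _ → q * d) ⟩
    Sum M (λ _ → q * d)               ≡⟨ Sum-const M (q * d) ⟩
    M * (q * d)                       ∎
    where open ≡-Reasoning

-- The theorem: after discarding the degenerate cases excluded by the
-- hypotheses (n = 0, N = 0, k < 2, d = 0), the labelling above gives the parts.
proposition7 : (n m N M k : ℕ) (σ : Fin N → Fin n) (τ : Fin M → Fin m) →
    3 ≤ n → 3 ≤ m → 0 < N →
    StrictInc σ → StrictInc τ →
    DistanceRegular n σ →
    2 ≤ k → k ∣ N → k ≤ M → ModEq 2 M k →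
    ∃ λ (f : Fin n → Fin M → Fin k) →
      (∃ λ c → ∀ ℓ → partSize f ℓ ≡ c) ×
      (∀ u j → Wiggle.InV k σ τ (f u j) u (τ j))
proposition7 (suc n′) m (suc N′) M k@(suc (suc _)) σ τ _ _ _ σ-inc _
             (d@(suc _) , _ , gaps) _ (divides q N≡qk) _ _ =
  label , (M * (q * d) , part-size) , label-in-cycle
  where open Labelling k σ τ σ-inc d gaps q N≡qk
proposition7 (suc _) _ (suc _) _ (suc (suc _)) _ _ _ _ _ _ _ (zero , () , _) _ _ _ _
proposition7 zero _ _ _ _ _ _ () _ _ _ _ _ _ _ _ _
proposition7 (suc _) _ zero _ _ _ _ _ _ () _ _ _ _ _ _ _
proposition7 (suc _) _ (suc _) _ zero _ _ _ _ _ _ _ _ () _ _ _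
proposition7 (suc _) _ (suc _) _ (suc zero) _ _ _ _ _ _ _ _ (s≤s ()) _ _ _
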